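{- Let $\mathcal{F} \subset \mathcal{P}([n])$ be an $r$-closed $\theta$-intersecting family, where $r \geq 3$ and $\theta \in (0,1)$. If $A, B \in \mathcal{F}_{\mathrm{nor}}$ with $|A| < |B|$, then $\mathrm{core}(A) \subsetneq \mathrm{core}(B)$.
   Context: A family $\mathcal{F} \subset \mathcal{P}([n])$ is $r$-closed $\theta$-intersecting if for each $2 \leq t \leq r$ and any $t$ distinct sets $A_1,\dots,A_t \in \mathcal{F}$ we have $|A_1 \cap \dots \cap A_t| \in \{\theta|A_1|, \dots, \theta|A_t|\}$. $\mathcal{F}(i) := \mathcal{F} \cap \binom{[n]}{i}$. For $A \in \mathcal{F}$, $\mathrm{Tor}(A) := \{B \in \mathcal{F} : |B| \geq |A|,\ |A \cap B| = \theta|A|\}$. When $\mathrm{Tor}(A) \neq \emptyset$, $\mathrm{core}(A) := A \cap B$ for any $B \in \mathrm{Tor}(A)$ (this does not depend on the choice of $B$). Let $S := \{i \in [n] : \mathcal{F}(i) \neq \emptyset\}$, $S_{\mathrm{nor}} := \{i \in S : \mathrm{Tor}(A) \neq \emptyset \text{ for all } A \in \mathcal{F}(i)\}$, and $\mathcal{F}_{\mathrm{nor}} := \bigcup_{i \in S_{\mathrm{nor}}} \mathcal{F}(i)$.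
   Formalization: The parameter θ ranges over the rationals in (0,1) instead of the real interval (0,1). -}

module Defs where

open import Data.Nat using (ℕ; _≤_; _<_; _≥_)
open import Data.Integer using (+_)
open import Data.Rational using (ℚ; _/_; _*_; 0ℚ; 1ℚ) renaming (_<_ to _<ℚ_)
open import Data.Fin using (Fin)
open import Data.Fin.Subset using (Subset; _∩_; ⋂; ∣_∣)
open import Data.List using (tabulate)
open import Data.Product using (Σ; ∃; _×_)
open import Relation.Binary.PropositionalEquality using (_≡_)

toℚ : ℕ → ℚ
toℚ k = + k / 1

Family : ℕ → Set₁
Family n = Subset n → Set

⋂ᶠ : ∀ {n t} → (Fin t → Subset n) → Subset n
⋂ᶠ A = ⋂ (tabulate A)

RClosedThetaIntersecting : ∀ {n} → ℕ → ℚ → Family n → Set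
RClosedThetaIntersecting {n} r θ F =
  ∀ (t : ℕ) → 2 ≤ t → t ≤ r →
  (A : Fin t → Subset n) →
  (∀ i j → A i ≡ A j → i ≡ j) →
  (∀ i → F (A i)) →
  ∃ λ (i : Fin t) → toℚ ∣ ⋂ᶠ A ∣ ≡ θ * toℚ ∣ A i ∣

InTor : ∀ {n} → ℚ → Family n → Subset n → Subset n → Set
InTor θ F A B = F B × ∣ B ∣ ≥ ∣ A ∣ × toℚ ∣ A ∩ B ∣ ≡ θ * toℚ ∣ A ∣

TorNonEmpty : ∀ {n} → ℚ → Family n → Subset n → Set
TorNonEmpty θ F A = ∃ λ B → InTor θ F A B

-- A ∈ F_nor : A ∈ F and |A| ∈ S_nor, i.e. every member of F(|A|) has nonempty Tor
InFnor : ∀ {n} → ℚ → Family n → Subset n → Set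
InFnor {n} θ F A =
  F A × (∀ (A' : Subset n) → F A' → ∣ A' ∣ ≡ ∣ A ∣ → TorNonEmpty θ F A')

IsCore : ∀ {n} → ℚ → Family n → Subset n → Subset n → Set
IsCore θ F A C = ∃ λ B → InTor θ F A B × C ≡ A ∩ B

{-# OPTIONS --safe #-}
-- Let core(A) = A ∩ A' with A' ∈ Tor(A), and let X ∈ F be strictly larger than A.
-- If X ≠ A', the sets A, A', X are distinct (A ≠ A' unless A = ∅, as θ < 1), so by
-- 3-closedness |A ∩ A' ∩ X| = θ|V| for some V ∈ {A, A', X}; every such V has
-- |V| ≥ |A|, hence |A ∩ A' ∩ X| ≥ θ|A| = |A ∩ A'| and core(A) ⊆ X.  Applying this to
-- X = B and X = B' ∈ Tor(B) gives core(A) ⊆ B ∩ B' = core(B), and the inclusion is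
-- strict because |core(A)| = θ|A| < θ|B| = |core(B)|.
module Submission where

open import Defs
open import Data.Nat using (ℕ; _≤_; _<_; zero; suc; z≤n; s≤s)
open import Data.Rational using (ℚ; 0ℚ; 1ℚ) renaming (_<_ to _<ℚ_)
open import Data.Fin.Subset using (Subset; _⊂_; ∣_∣; _⊆_; _∩_; inside; outside)

import Data.Nat.Properties as ℕ
open import Data.Integer as ℤ using (+_)
import Data.Integer.Properties as ℤ
open import Data.Rational as ℚ using (mkℚ; _*_)
import Data.Rational.Properties as ℚ
import Data.Nat.Coprimality as Coprimality
open import Data.Bool.Properties using () renaming (_≟_ to _≟ᴮ_)
open import Data.Vec using ([]; _∷_; here; there; lookup)
open import Data.Vec.Properties using (≡-dec)
open import Data.Fin using (Fin; zero; suc)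
open import Data.Fin.Subset.Properties
open import Data.Product using (_,_)
open import Data.Empty using (⊥-elim)
open import Relation.Nullary using (yes; no)
open import Relation.Binary.PropositionalEquality

p⊆q⇒∣q∣≤∣p∣⇒q⊆p : ∀ {n} {p q : Subset n} → p ⊆ q → ∣ q ∣ ≤ ∣ p ∣ → q ⊆ p
p⊆q⇒∣q∣≤∣p∣⇒q⊆p {p = outside ∷ p} {outside ∷ q} p⊆q ∣q∣≤∣p∣ (there x∈q) =
  there (p⊆q⇒∣q∣≤∣p∣⇒q⊆p (drop-∷-⊆ p⊆q) ∣q∣≤∣p∣ x∈q)
p⊆q⇒∣q∣≤∣p∣⇒q⊆p {p = outside ∷ p} {inside ∷ q} p⊆q ∣q∣≤∣p∣ _ =
  ⊥-elim (ℕ.<-irrefl refl (ℕ.≤-trans ∣q∣≤∣p∣ (p⊆q⇒∣p∣≤∣q∣ (drop-∷-⊆ p⊆q))))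
p⊆q⇒∣q∣≤∣p∣⇒q⊆p {p = inside ∷ p} {outside ∷ q} p⊆q _ _ with p⊆q here
... | ()
p⊆q⇒∣q∣≤∣p∣⇒q⊆p {p = inside ∷ p} {inside ∷ q} p⊆q _ here = here
p⊆q⇒∣q∣≤∣p∣⇒q⊆p {p = inside ∷ p} {inside ∷ q} p⊆q (s≤s ∣q∣≤∣p∣) (there x∈q) =
  there (p⊆q⇒∣q∣≤∣p∣⇒q⊆p (drop-∷-⊆ p⊆q) ∣q∣≤∣p∣ x∈q)

p⊆q⇒∣p∣<∣q∣⇒p⊂q : ∀ {n} {p q : Subset n} → p ⊆ q → ∣ p ∣ < ∣ q ∣ → p ⊂ q
p⊆q⇒∣p∣<∣q∣⇒p⊂q {p = outside ∷ p} {outside ∷ q} p⊆q ∣p∣<∣q∣ =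
  s⊂s (p⊆q⇒∣p∣<∣q∣⇒p⊂q (drop-∷-⊆ p⊆q) ∣p∣<∣q∣)
p⊆q⇒∣p∣<∣q∣⇒p⊂q {p = outside ∷ p} {inside ∷ q} p⊆q _ = out⊂in (drop-∷-⊆ p⊆q)
p⊆q⇒∣p∣<∣q∣⇒p⊂q {p = inside ∷ p} {outside ∷ q} p⊆q _ with p⊆q here
... | ()
p⊆q⇒∣p∣<∣q∣⇒p⊂q {p = inside ∷ p} {inside ∷ q} p⊆q (s≤s ∣p∣<∣q∣) =
  s⊂s (p⊆q⇒∣p∣<∣q∣⇒p⊂q (drop-∷-⊆ p⊆q) ∣p∣<∣q∣)

∣p∣≤∣p∩q∣⇒p⊆q : ∀ {n} {p q : Subset n} → ∣ p ∣ ≤ ∣ p ∩ q ∣ → p ⊆ q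
∣p∣≤∣p∩q∣⇒p⊆q {p = p} {q} ∣p∣≤∣p∩q∣ =
  ⊆-trans (p⊆q⇒∣q∣≤∣p∣⇒q⊆p (p∩q⊆p p q) ∣p∣≤∣p∩q∣) (p∩q⊆q p q)

∣p∣≡0⇒p⊆q : ∀ {n} {p q : Subset n} → ∣ p ∣ ≡ 0 → p ⊆ q
∣p∣≡0⇒p⊆q {p = p} {q} ∣p∣≡0 = ∣p∣≤∣p∩q∣⇒p⊆q (subst (_≤ ∣ p ∩ q ∣) (sym ∣p∣≡0) z≤n)

toℚ≡mkℚ : ∀ k → toℚ k ≡ mkℚ (+ k) 0 (Coprimality.sym (Coprimality.1-coprimeTo k))
toℚ≡mkℚ k = ℚ.normalize-coprime (Coprimality.sym (Coprimality.1-coprimeTo k))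

toℚ-mono-≤ : ∀ {a b} → a ≤ b → toℚ a ℚ.≤ toℚ b
toℚ-mono-≤ {a} {b} a≤b rewrite toℚ≡mkℚ a | toℚ≡mkℚ b =
  ℚ.*≤* (subst₂ ℤ._≤_ (sym (ℤ.*-identityʳ (+ a))) (sym (ℤ.*-identityʳ (+ b))) (ℤ.+≤+ a≤b))

toℚ-cancel-≤ : ∀ {a b} → toℚ a ℚ.≤ toℚ b → a ≤ b
toℚ-cancel-≤ {a} {b} a≤b rewrite toℚ≡mkℚ a | toℚ≡mkℚ b with a≤b
... | ℚ.*≤* a≤b = ℤ.drop‿+≤+ (subst₂ ℤ._≤_ (ℤ.*-identityʳ (+ a)) (ℤ.*-identityʳ (+ b)) a≤b)

toℚ-mono-< : ∀ {a b} → a < b → toℚ a <ℚ toℚ b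
toℚ-mono-< {a} {b} a<b rewrite toℚ≡mkℚ a | toℚ≡mkℚ b =
  ℚ.*<* (subst₂ ℤ._<_ (sym (ℤ.*-identityʳ (+ a))) (sym (ℤ.*-identityʳ (+ b))) (ℤ.+<+ a<b))

toℚ-cancel-< : ∀ {a b} → toℚ a <ℚ toℚ b → a < b
toℚ-cancel-< {a} {b} a<b rewrite toℚ≡mkℚ a | toℚ≡mkℚ b with a<b
... | ℚ.*<* a<b = ℤ.drop‿+<+ (subst₂ ℤ._<_ (ℤ.*-identityʳ (+ a)) (ℤ.*-identityʳ (+ b)) a<b)

toℚ≡θ*toℚ⇒≡0 : ∀ {θ} k → θ <ℚ 1ℚ → toℚ k ≡ θ * toℚ k → k ≡ 0
toℚ≡θ*toℚ⇒≡0 zero _ _ = refl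
toℚ≡θ*toℚ⇒≡0 {θ} (suc k) θ<1 k≡θk = ⊥-elim (ℚ.<-irrefl (sym k≡θk) θk<k)
  where
  instance
    k-pos : ℚ.Positive (toℚ (suc k))
    k-pos = ℚ.positive (toℚ-mono-< {0} {suc k} (s≤s z≤n))
  θk<k : θ * toℚ (suc k) <ℚ toℚ (suc k)
  θk<k = subst (θ * toℚ (suc k) <ℚ_) (ℚ.*-identityˡ (toℚ (suc k)))
               (ℚ.*-monoˡ-<-pos (toℚ (suc k)) θ<1)

triple : ∀ {n} → Subset n → Subset n → Subset n → Fin 3 → Subset n
triple A B C = lookup (A ∷ B ∷ C ∷ [])

triple-injective : ∀ {n} {A B C : Subset n} → A ≢ B → A ≢ C → B ≢ C →
  ∀ i j → triple A B C i ≡ triple A B C j → i ≡ j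
triple-injective A≢B A≢C B≢C = λ where
  zero zero _ → refl
  zero (suc zero) A≡B → ⊥-elim (A≢B A≡B)
  zero (suc (suc zero)) A≡C → ⊥-elim (A≢C A≡C)
  (suc zero) zero B≡A → ⊥-elim (A≢B (sym B≡A))
  (suc zero) (suc zero) _ → refl
  (suc zero) (suc (suc zero)) B≡C → ⊥-elim (B≢C B≡C)
  (suc (suc zero)) zero C≡A → ⊥-elim (A≢C (sym C≡A))
  (suc (suc zero)) (suc zero) C≡B → ⊥-elim (B≢C (sym C≡B))
  (suc (suc zero)) (suc (suc zero)) _ → refl

⋂ᶠ-triple : ∀ {n} (A B C : Subset n) → ⋂ᶠ (triple A B C) ≡ (A ∩ B) ∩ C
⋂ᶠ-triple A B C = trans (cong (λ s → A ∩ (B ∩ s)) (∩-identityʳ C)) (sym (∩-assoc A B C))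

module _ {n r : ℕ} {θ : ℚ} {F : Family n} (closed : RClosedThetaIntersecting r θ F) where

  θ*lowerBound≤∣⋂ᶠ∣ : .{{_ : ℚ.NonNegative θ}} →
    ∀ t → 2 ≤ t → t ≤ r → (A : Fin t → Subset n) →
    (∀ i j → A i ≡ A j → i ≡ j) → (∀ i → F (A i)) →
    ∀ k → (∀ i → k ≤ ∣ A i ∣) → θ * toℚ k ℚ.≤ toℚ ∣ ⋂ᶠ A ∣
  θ*lowerBound≤∣⋂ᶠ∣ t 2≤t t≤r A distinct A∈F k k≤∣A∣ with closed t 2≤t t≤r A distinct A∈F
  ... | i , ∣⋂A∣≡θ∣Ai∣ =
    subst (θ * toℚ k ℚ.≤_) (sym ∣⋂A∣≡θ∣Ai∣) (ℚ.*-monoˡ-≤-nonNeg θ (toℚ-mono-≤ (k≤∣A∣ i)))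

  core⊆distinct : .{{_ : ℚ.NonNegative θ}} → 3 ≤ r → ∀ {A A' X} →
    F A → InTor θ F A A' → F X → A ≢ A' → A ≢ X → A' ≢ X → ∣ A ∣ ≤ ∣ X ∣ →
    A ∩ A' ⊆ X
  core⊆distinct 3≤r {A} {A'} {X} A∈F (A'∈F , ∣A∣≤∣A'∣ , core) X∈F A≢A' A≢X A'≢X ∣A∣≤∣X∣ =
    ∣p∣≤∣p∩q∣⇒p⊆q (toℚ-cancel-≤ (begin
      toℚ ∣ A ∩ A' ∣                ≡⟨ core ⟩
      θ * toℚ ∣ A ∣                 ≤⟨ θ*lowerBound≤∣⋂ᶠ∣ 3 (s≤s (s≤s z≤n)) 3≤r (triple A A' X)
                                         (triple-injective A≢A' A≢X A'≢X) members ∣ A ∣ sizes ⟩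
      toℚ ∣ ⋂ᶠ (triple A A' X) ∣    ≡⟨ cong (λ s → toℚ ∣ s ∣) (⋂ᶠ-triple A A' X) ⟩
      toℚ ∣ (A ∩ A') ∩ X ∣          ∎))
    where
    open ℚ.≤-Reasoning
    members : ∀ i → F (triple A A' X i)
    members zero = A∈F
    members (suc zero) = A'∈F
    members (suc (suc zero)) = X∈F
    sizes : ∀ i → ∣ A ∣ ≤ ∣ triple A A' X i ∣
    sizes zero = ℕ.≤-refl
    sizes (suc zero) = ∣A∣≤∣A'∣
    sizes (suc (suc zero)) = ∣A∣≤∣X∣

  core⊆larger : .{{_ : ℚ.NonNegative θ}} → 3 ≤ r → θ <ℚ 1ℚ → ∀ {A A' X} →
    F A → InTor θ F A A' → F X → ∣ A ∣ < ∣ X ∣ → A ∩ A' ⊆ X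
  core⊆larger 3≤r θ<1 {A} {A'} {X} A∈F A'∈Tor@(_ , _ , core) X∈F ∣A∣<∣X∣
    with ≡-dec _≟ᴮ_ A' X | ≡-dec _≟ᴮ_ A A'
  ... | yes refl | _ = p∩q⊆q A A'
  ... | no _ | yes refl = ⊆-trans (p∩q⊆p A A) (∣p∣≡0⇒p⊆q ∣A∣≡0)
    where
    ∣A∣≡0 : ∣ A ∣ ≡ 0
    ∣A∣≡0 = toℚ≡θ*toℚ⇒≡0 ∣ A ∣ θ<1
      (subst (λ s → toℚ ∣ s ∣ ≡ θ * toℚ ∣ A ∣) (∩-idem A) core)
  ... | no A'≢X | no A≢A' =
    core⊆distinct 3≤r A∈F A'∈Tor X∈F A≢A' (λ A≡X → ℕ.<⇒≢ ∣A∣<∣X∣ (cong ∣_∣ A≡X)) A'≢X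
      (ℕ.<⇒≤ ∣A∣<∣X∣)

lemma2p12 : (n r : ℕ) (θ : ℚ) (F : Family n) →
    3 ≤ r → 0ℚ <ℚ θ → θ <ℚ 1ℚ →
    RClosedThetaIntersecting r θ F →
    (A B : Subset n) → InFnor θ F A → InFnor θ F B → ∣ A ∣ < ∣ B ∣ →
    (cA cB : Subset n) → IsCore θ F A cA → IsCore θ F B cB →
    cA ⊂ cB
lemma2p12 n r θ F 3≤r 0<θ θ<1 closed A B (A∈F , _) (B∈F , _) ∣A∣<∣B∣ _ _
  (A' , A'∈Tor@(_ , _ , coreA) , refl) (B' , (B'∈F , ∣B∣≤∣B'∣ , coreB) , refl) =
  p⊆q⇒∣p∣<∣q∣⇒p⊂q coreA⊆coreB ∣coreA∣<∣coreB∣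
  where
  instance
    θ-pos : ℚ.Positive θ
    θ-pos = ℚ.positive 0<θ
    θ-nonNeg : ℚ.NonNegative θ
    θ-nonNeg = ℚ.pos⇒nonNeg θ
  coreA⊆coreB : A ∩ A' ⊆ B ∩ B'
  coreA⊆coreB x∈coreA = x∈p∩q⁺
    ( core⊆larger closed 3≤r θ<1 A∈F A'∈Tor B∈F ∣A∣<∣B∣ x∈coreA
    , core⊆larger closed 3≤r θ<1 A∈F A'∈Tor B'∈F (ℕ.<-≤-trans ∣A∣<∣B∣ ∣B∣≤∣B'∣) x∈coreA )
  ∣coreA∣<∣coreB∣ : ∣ A ∩ A' ∣ < ∣ B ∩ B' ∣
  ∣coreA∣<∣coreB∣ = toℚ-cancel-< (subst₂ _<ℚ_ (sym coreA) (sym coreB)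
    (ℚ.*-monoʳ-<-pos θ (toℚ-mono-< ∣A∣<∣B∣)))
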